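{- Let $G$ be a graph with at least one edge, and let $\delta = \operatorname{emin}(G)$. Then, as $n \to \infty$, \[\operatorname{sat}(Q_n, G) \ge (\delta - 1 + o(1)) \cdot 2^{n-2}.\]
   Context: $Q_n$ is the $n$-dimensional hypercube: vertex set $\{0,1\}^n$, two vertices adjacent iff they differ in exactly one coordinate. For a host graph $H$ and a graph $G$, a subgraph $H'$ of $H$ is $(H,G)$-saturated if $H'$ contains no subgraph isomorphic to $G$, but adding any edge of $E(H)\setminus E(H')$ to $H'$ creates a subgraph isomorphic to $G$. The saturation number $\operatorname{sat}(H,G)$ is the minimum number of edges of an $(H,G)$-saturated subgraph of $H$. For a graph $G$, $\operatorname{emin}(G)$ is the minimum, over all edges $uv$ of $G$, of $\max(\deg_G u, \deg_G v)$. -}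

module Defs where

open import Data.Nat using (ℕ; zero; suc; _+_; _*_; _⊔_; _≤_; _/_)
open import Data.Bool using (Bool; true; false; _∨_; if_then_else_)
open import Data.Fin using (Fin)
open import Data.List using (List; []; _∷_; map; _++_; allFin)
open import Data.Nat.ListAction using (sum)
open import Data.Vec using (Vec; []; _∷_)
open import Data.Product using (Σ; _×_; ∃)
open import Relation.Binary.PropositionalEquality using (_≡_; _≢_)
open import Relation.Nullary using (¬_)
open import Data.Vec.Properties using (≡-dec)
open import Data.Bool.Properties using () renaming (_≟_ to _≟B_)
open import Relation.Nullary.Decidable using (⌊_⌋)

record SimpleGraph : Set where
  field
    k    : ℕ
    adj  : Fin k → Fin k → Bool
    sym  : ∀ i j → adj i j ≡ adj j i
    irr  : ∀ i → adj i i ≡ false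

open SimpleGraph public

b2n : Bool → ℕ
b2n true  = 1
b2n false = 0

deg : (G : SimpleGraph) → Fin (k G) → ℕ
deg G i = sum (map (λ j → b2n (adj G i j)) (allFin (k G)))

HasEdge : SimpleGraph → Set
HasEdge G = Σ (Fin (k G)) λ i → Σ (Fin (k G)) λ j → adj G i j ≡ true

IsEmin : SimpleGraph → ℕ → Set
IsEmin G δ =
  (Σ (Fin (k G)) λ i → Σ (Fin (k G)) λ j →
     (adj G i j ≡ true) × (deg G i ⊔ deg G j ≡ δ))
  × (∀ i j → adj G i j ≡ true → δ ≤ deg G i ⊔ deg G j)

Vertex : ℕ → Set
Vertex n = Vec Bool n

allVertices : (n : ℕ) → List (Vertex n)
allVertices zero    = [] ∷ []
allVertices (suc n) = map (false ∷_) (allVertices n) ++ map (true ∷_) (allVertices n)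

hamming : ∀ {n} → Vertex n → Vertex n → ℕ
hamming []       []       = 0
hamming (a ∷ u)  (b ∷ v)  = (if ⌊ a ≟B b ⌋ then 0 else 1) + hamming u v

QAdj : ∀ {n} → Vertex n → Vertex n → Set
QAdj u v = hamming u v ≡ 1

record SubQ (n : ℕ) : Set where
  field
    E     : Vertex n → Vertex n → Bool
    Esym  : ∀ u v → E u v ≡ E v u
    Esub  : ∀ u v → E u v ≡ true → QAdj u v

open SubQ public

edgeCount : ∀ {n} → SubQ n → ℕ
edgeCount {n} H =
  sum (map (λ u → sum (map (λ v → b2n (E H u v)) (allVertices n))) (allVertices n)) / 2

ContainsCopy : ∀ {n} → (G : SimpleGraph) → (Vertex n → Vertex n → Bool) → Set
ContainsCopy {n} G R =
  Σ (Fin (k G) → Vertex n) λ f →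
    (∀ i j → f i ≡ f j → i ≡ j) ×
    (∀ i j → adj G i j ≡ true → R (f i) (f j) ≡ true)

addEdge : ∀ {n} → (Vertex n → Vertex n → Bool) → Vertex n → Vertex n →
          Vertex n → Vertex n → Bool
addEdge R u v x y =
  R x y ∨ (⌊ ≡-dec _≟B_ x u ⌋ Data.Bool.∧ ⌊ ≡-dec _≟B_ y v ⌋)
        ∨ (⌊ ≡-dec _≟B_ x v ⌋ Data.Bool.∧ ⌊ ≡-dec _≟B_ y u ⌋)

Saturated : ∀ {n} → SimpleGraph → SubQ n → Set
Saturated G H =
  ¬ ContainsCopy G (E H)
  × (∀ u v → QAdj u v → E H u v ≡ false → ContainsCopy G (addEdge (E H) u v))

-- Let d = emin(G) - 1, let H be a (Q_n,G)-saturated subgraph, D the sum of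
-- the H-degrees (so |E(H)| = ⌊D/2⌋), call a vertex high if its H-degree is
-- at least d, and let h be the number of high vertices.
-- (1) Every edge uv of Q_n missing from H has a high endpoint: a copy of G
--     in H + uv that is not a copy in H sends some edge ab of G onto uv, and
--     injectivity gives deg_G a ≤ deg_H u + 1 and deg_G b ≤ deg_H v + 1,
--     while max(deg_G a, deg_G b) ≥ emin(G).
-- (2) Double counting the n·2^n pairs (vertex u, direction i): each is
--     covered by the H-edge from u in direction i or by a high endpoint, so
--     n·2^n ≤ D + 2nh; with dh ≤ D this gives d·n·2^n ≤ (d + 2n)·D.
-- (3) Elementary arithmetic turns (2) into the stated inequality once n is
--     large compared with d and the precision parameter.
module Submission where

open import Defs hiding (sym)
open import Data.Nat using (ℕ; zero; suc; _+_; _*_; _∸_; _^_; _≤_; _<_; _⊔_; _≤ᵇ_; _/_; _%_; z≤n; s≤s; >-nonZero)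
open import Data.Nat.Properties
open import Data.Nat.ListAction using (sum)
open import Data.Nat.DivMod using (m≡m%n+[m/n]*n; m%n<n)
open import Data.Nat.Tactic.RingSolver using (solve-∀)
open import Algebra.Properties.CommutativeSemigroup +-commutativeSemigroup using (interchange; x∙yz≈y∙xz)
open import Data.Bool using (Bool; true; false; not; _∧_; _∨_; T)
import Data.Bool.Properties as BoolP
open import Data.Unit using (tt)
open import Data.Empty using (⊥-elim)
open import Data.Fin using (Fin; zero; suc)
import Data.Fin.Properties as FinP
open import Data.Vec using ([]; _∷_; head)
open import Data.Vec.Properties using (≡-dec)
open import Data.List using (List; []; _∷_; map; _++_; allFin; length)
open import Data.List.Properties using (length-++; length-map; length-tabulate)
open import Data.List.Membership.Propositional using (_∈_)
open import Data.List.Membership.Propositional.Properties using (∈-map⁺; ∈-map⁻; ∈-++⁺ˡ; ∈-++⁺ʳ)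
open import Data.List.Relation.Unary.Any using (here; there)
open import Data.List.Relation.Unary.All as All using (All; []; _∷_)
open import Data.List.Relation.Unary.AllPairs using ([]; _∷_)
open import Data.List.Relation.Unary.Unique.Propositional using (Unique)
import Data.List.Relation.Unary.Unique.Propositional.Properties as UniqueP
open import Data.Product using (Σ; _×_; _,_; proj₁; proj₂)
open import Data.Sum using (_⊎_; inj₁; inj₂)
open import Relation.Binary.Definitions using (DecidableEquality)
open import Relation.Binary.PropositionalEquality
open import Relation.Nullary using (¬_; Dec; yes; no; contradiction)
open import Relation.Nullary.Decidable using (⌊_⌋; _→-dec_)

∑ : {A : Set} → List A → (A → ℕ) → ℕ
∑ xs f = sum (map f xs)

∑-mono : {A : Set} (xs : List A) {f g : A → ℕ} → (∀ x → f x ≤ g x) → ∑ xs f ≤ ∑ xs g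
∑-mono []       f≤g = z≤n
∑-mono (x ∷ xs) f≤g = +-mono-≤ (f≤g x) (∑-mono xs f≤g)

∑-+ : {A : Set} (xs : List A) (f g : A → ℕ) → ∑ xs (λ x → f x + g x) ≡ ∑ xs f + ∑ xs g
∑-+ []       f g = refl
∑-+ (x ∷ xs) f g = trans (cong (f x + g x +_) (∑-+ xs f g)) (interchange (f x) (g x) (∑ xs f) (∑ xs g))

∑-*ˡ : {A : Set} (xs : List A) (c : ℕ) (f : A → ℕ) → ∑ xs (λ x → c * f x) ≡ c * ∑ xs f
∑-*ˡ []       c f = sym (*-zeroʳ c)
∑-*ˡ (x ∷ xs) c f = trans (cong (c * f x +_) (∑-*ˡ xs c f)) (sym (*-distribˡ-+ c (f x) (∑ xs f)))

∑-const : {A : Set} (xs : List A) (c : ℕ) → ∑ xs (λ _ → c) ≡ c * length xs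
∑-const []       c = sym (*-zeroʳ c)
∑-const (x ∷ xs) c = trans (cong (c +_) (∑-const xs c)) (sym (*-suc c (length xs)))

∑-swap : {A B : Set} (xs : List A) (ys : List B) (f : A → B → ℕ) →
  ∑ xs (λ x → ∑ ys (f x)) ≡ ∑ ys (λ y → ∑ xs (λ x → f x y))
∑-swap []       ys f = sym (∑-const ys 0)
∑-swap (x ∷ xs) ys f =
  trans (cong (∑ ys (f x) +_) (∑-swap xs ys f)) (sym (∑-+ ys (f x) (λ y → ∑ xs (λ x → f x y))))

remove : {B : Set} {y : B} (ys : List B) → y ∈ ys → List B
remove (_ ∷ ys) (here _)  = ys
remove (z ∷ ys) (there p) = z ∷ remove ys p

∑-remove : {B : Set} {y : B} (ys : List B) (p : y ∈ ys) (w : B → ℕ) →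
  ∑ ys w ≡ w y + ∑ (remove ys p) w
∑-remove (_ ∷ ys) (here refl) w = refl
∑-remove (z ∷ ys) (there p)   w =
  trans (cong (w z +_) (∑-remove ys p w)) (x∙yz≈y∙xz (w z) _ (∑ (remove ys p) w))

∈-remove : {B : Set} {y z : B} (ys : List B) → z ∈ ys → ¬ z ≡ y → (p : y ∈ ys) → z ∈ remove ys p
∈-remove (_ ∷ ys) (here refl) z≢y (here refl) = ⊥-elim (z≢y refl)
∈-remove (_ ∷ ys) (there q)   z≢y (here refl) = q
∈-remove (_ ∷ ys) (here e)    z≢y (there p)   = here e
∈-remove (_ ∷ ys) (there q)   z≢y (there p)   = there (∈-remove ys q z≢y p)

∑-injective-≤ : {A B : Set} (g : A → B) → (∀ {x x'} → g x ≡ g x' → x ≡ x') → (w : B → ℕ) →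
  (xs : List A) → Unique xs → (ys : List B) → (∀ {x} → x ∈ xs → g x ∈ ys) →
  ∑ xs (λ x → w (g x)) ≤ ∑ ys w
∑-injective-≤ g g-inj w []       _              ys xs⊆ys = z≤n
∑-injective-≤ g g-inj w (x ∷ xs) (x∉xs ∷ uniq) ys xs⊆ys =
  subst (w (g x) + ∑ xs (λ x → w (g x)) ≤_) (sym (∑-remove ys gx∈ys w))
    (+-monoʳ-≤ (w (g x)) (∑-injective-≤ g g-inj w xs uniq (remove ys gx∈ys) rest⊆))
  where
  gx∈ys : g x ∈ ys
  gx∈ys = xs⊆ys (here refl)
  rest⊆ : ∀ {x'} → x' ∈ xs → g x' ∈ remove ys gx∈ys
  rest⊆ q = ∈-remove ys (xs⊆ys (there q)) (λ e → All.lookup x∉xs q (sym (g-inj e))) gx∈ys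

module _ {A : Set} (_≟_ : DecidableEquality A) where

  count-absent : {y : A} (xs : List A) → All (λ z → ¬ y ≡ z) xs → ∑ xs (λ z → b2n ⌊ z ≟ y ⌋) ≡ 0
  count-absent     []       [] = refl
  count-absent {y} (z ∷ xs) (y≢z ∷ y∉xs) with z ≟ y
  ... | yes z≡y = contradiction (sym z≡y) y≢z
  ... | no  _   = count-absent xs y∉xs

  count-unique : {y : A} (xs : List A) → Unique xs → ∑ xs (λ z → b2n ⌊ z ≟ y ⌋) ≤ 1
  count-unique     []       [] = z≤n
  count-unique {y} (z ∷ xs) (z∉xs ∷ uniq) with z ≟ y
  ... | yes refl = ≤-reflexive (cong suc (count-absent xs z∉xs))
  ... | no  _    = count-unique xs uniq

-- equality of vertices, the test used in addEdge
_≟V_ : ∀ {n} → DecidableEquality (Vertex n)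
_≟V_ = ≡-dec BoolP._≟_

∷-injective : ∀ {n} {b : Bool} {u v : Vertex n} → b ∷ u ≡ b ∷ v → u ≡ v
∷-injective refl = refl

∈-allVertices : ∀ {n} (v : Vertex n) → v ∈ allVertices n
∈-allVertices []              = here refl
∈-allVertices {suc n} (false ∷ v) = ∈-++⁺ˡ (∈-map⁺ (false ∷_) (∈-allVertices v))
∈-allVertices {suc n} (true ∷ v)  =
  ∈-++⁺ʳ (map (false ∷_) (allVertices n)) (∈-map⁺ (true ∷_) (∈-allVertices v))

allVertices-unique : ∀ n → Unique (allVertices n)
allVertices-unique zero    = [] ∷ []
allVertices-unique (suc n) =
  UniqueP.++⁺ (UniqueP.map⁺ ∷-injective (allVertices-unique n))
              (UniqueP.map⁺ ∷-injective (allVertices-unique n)) halves-disjoint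
  where
  halves-disjoint : ∀ {z} → ¬ (z ∈ map (false ∷_) (allVertices n) × z ∈ map (true ∷_) (allVertices n))
  halves-disjoint (p , q) with ∈-map⁻ (false ∷_) p | ∈-map⁻ (true ∷_) q
  ... | _ , _ , refl | _ , _ , ()

length-allVertices : ∀ n → length (allVertices n) ≡ 2 ^ n
length-allVertices zero    = refl
length-allVertices (suc n) = begin
  length (map (false ∷_) (allVertices n) ++ map (true ∷_) (allVertices n))
    ≡⟨ length-++ (map (false ∷_) (allVertices n)) ⟩
  length (map (false ∷_) (allVertices n)) + length (map (true ∷_) (allVertices n))
    ≡⟨ cong₂ _+_ (length-map (false ∷_) (allVertices n)) (length-map (true ∷_) (allVertices n)) ⟩
  length (allVertices n) + length (allVertices n)
    ≡⟨ cong₂ _+_ (length-allVertices n) (trans (length-allVertices n) (sym (+-identityʳ (2 ^ n)))) ⟩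
  2 ^ suc n ∎
  where open ≡-Reasoning

n<2^n : ∀ n → n < 2 ^ n
n<2^n zero    = s≤s z≤n
n<2^n (suc n) = subst (suc (suc n) ≤_) (cong (2 ^ n +_) (sym (+-identityʳ (2 ^ n))))
  (+-mono-≤ (m^n>0 2 n) (n<2^n n))

hamming-refl : ∀ {n} (u : Vertex n) → hamming u u ≡ 0
hamming-refl []          = refl
hamming-refl (false ∷ u) = hamming-refl u
hamming-refl (true ∷ u)  = hamming-refl u

adjacent⇒≢ : ∀ {n} {u v : Vertex n} → QAdj u v → ¬ u ≡ v
adjacent⇒≢ {u = u} uv refl with trans (sym uv) (hamming-refl u)
... | ()

flipAt : ∀ {n} → Fin n → Vertex n → Vertex n
flipAt zero    (a ∷ u) = not a ∷ u
flipAt (suc i) (a ∷ u) = a ∷ flipAt i u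

flipAt-adjacent : ∀ {n} (i : Fin n) (u : Vertex n) → QAdj u (flipAt i u)
flipAt-adjacent zero    (false ∷ u) = cong suc (hamming-refl u)
flipAt-adjacent zero    (true ∷ u)  = cong suc (hamming-refl u)
flipAt-adjacent (suc i) (false ∷ u) = flipAt-adjacent i u
flipAt-adjacent (suc i) (true ∷ u)  = flipAt-adjacent i u

flipAt-involutive : ∀ {n} (i : Fin n) (u : Vertex n) → flipAt i (flipAt i u) ≡ u
flipAt-involutive zero    (a ∷ u) = cong (_∷ u) (BoolP.not-involutive a)
flipAt-involutive (suc i) (a ∷ u) = cong (a ∷_) (flipAt-involutive i u)

flipAt-injective : ∀ {n} (i : Fin n) {u v : Vertex n} → flipAt i u ≡ flipAt i v → u ≡ v
flipAt-injective i {u} {v} e =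
  trans (sym (flipAt-involutive i u)) (trans (cong (flipAt i) e) (flipAt-involutive i v))

flipAt-injective-dir : ∀ {n} (u : Vertex n) {i j : Fin n} → flipAt i u ≡ flipAt j u → i ≡ j
flipAt-injective-dir (a ∷ u) {zero}  {zero}  e = refl
flipAt-injective-dir (a ∷ u) {zero}  {suc j} e = contradiction (sym (cong head e)) (BoolP.not-¬ refl)
flipAt-injective-dir (a ∷ u) {suc i} {zero}  e = contradiction (cong head e) (BoolP.not-¬ refl)
flipAt-injective-dir (a ∷ u) {suc i} {suc j} e = cong suc (flipAt-injective-dir u (∷-injective e))

degree : ∀ {n} → (Vertex n → Vertex n → Bool) → Vertex n → ℕ
degree {n} R x = ∑ (allVertices n) (λ z → b2n (R x z))

degreeSum : ∀ {n} → SubQ n → ℕ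
degreeSum {n} H = ∑ (allVertices n) (degree (E H))

degreeSum≤2edgeCount+1 : ∀ {n} (H : SubQ n) → degreeSum H ≤ 2 * edgeCount H + 1
degreeSum≤2edgeCount+1 H = begin
  D                 ≡⟨ m≡m%n+[m/n]*n D 2 ⟩
  D % 2 + D / 2 * 2 ≤⟨ +-monoˡ-≤ (D / 2 * 2) (≤-pred (m%n<n D 2)) ⟩
  1 + D / 2 * 2     ≡⟨ trans (+-comm 1 _) (cong (_+ 1) (*-comm (D / 2) 2)) ⟩
  2 * (D / 2) + 1   ∎
  where
  open ≤-Reasoning
  D : ℕ
  D = degreeSum H

-- (1) A missing edge of a saturated subgraph has a high endpoint

IsCopy : ∀ {n} (G : SimpleGraph) → (Vertex n → Vertex n → Bool) → (Fin (k G) → Vertex n) → Set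
IsCopy G R f = (∀ i j → f i ≡ f j → i ≡ j) × (∀ i j → adj G i j ≡ true → R (f i) (f j) ≡ true)

isYes-true : {A : Set} (a? : Dec A) → A → ⌊ a? ⌋ ≡ true
isYes-true (yes _) _ = refl
isYes-true (no ¬a) a = contradiction a ¬a

isYes-false : {A : Set} (a? : Dec A) → ¬ A → ⌊ a? ⌋ ≡ false
isYes-false (yes a) ¬a = contradiction a ¬a
isYes-false (no _)  _  = refl

isYes-sound : {A : Set} (a? : Dec A) → ⌊ a? ⌋ ≡ true → A
isYes-sound (yes a) _ = a

addEdge-comm : ∀ {n} (R : Vertex n → Vertex n → Bool) u v x y → addEdge R u v x y ≡ addEdge R v u x y
addEdge-comm R u v x y =
  cong (R x y ∨_) (BoolP.∨-comm (⌊ x ≟V u ⌋ ∧ ⌊ y ≟V v ⌋) (⌊ x ≟V v ⌋ ∧ ⌊ y ≟V u ⌋))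

addEdge-at-endpoint : ∀ {n} (R : Vertex n → Vertex n → Bool) (u v : Vertex n) → ¬ u ≡ v →
  ∀ z → b2n (addEdge R u v u z) ≤ b2n (R u z) + b2n ⌊ z ≟V v ⌋
addEdge-at-endpoint R u v u≢v z = bound (R u z) (isYes-true (u ≟V u) refl) (isYes-false (u ≟V v) u≢v)
  where
  bound : ∀ r {a b c d} → a ≡ true → c ≡ false → b2n (r ∨ (a ∧ b) ∨ (c ∧ d)) ≤ b2n r + b2n b
  bound true            _    _    = s≤s z≤n
  bound false {b = true}  refl refl = ≤-refl
  bound false {b = false} refl refl = z≤n

-- A copy f of G in R + uv sending a to u: the G-neighbours of a go
-- injectively to R-neighbours of u or to v, so deg_G a ≤ deg_R u + 1.
endpoint-degree : ∀ {n} (G : SimpleGraph) (R : Vertex n → Vertex n → Bool) (u v : Vertex n) → ¬ u ≡ v →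
  (f : Fin (k G) → Vertex n) → IsCopy G (addEdge R u v) f →
  ∀ a → f a ≡ u → deg G a ≤ degree R u + 1
endpoint-degree {n} G R u v u≢v f (f-inj , f-pres) a refl = begin
  ∑ (allFin (k G)) (λ j → b2n (adj G a j))  ≤⟨ ∑-mono (allFin (k G)) edge-weight ⟩
  ∑ (allFin (k G)) (λ j → w (f j))          ≤⟨ ∑-injective-≤ f (f-inj _ _) w (allFin (k G))
                                                 (UniqueP.allFin⁺ (k G)) (allVertices n) (λ {j} _ → ∈-allVertices (f j)) ⟩
  ∑ (allVertices n) w                       ≡⟨ ∑-+ (allVertices n) (λ z → b2n (R u z)) (λ z → b2n ⌊ z ≟V v ⌋) ⟩
  degree R u + ∑ (allVertices n) (λ z → b2n ⌊ z ≟V v ⌋)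
                                            ≤⟨ +-monoʳ-≤ (degree R u) (count-unique _≟V_ (allVertices n) (allVertices-unique n)) ⟩
  degree R u + 1                            ∎
  where
  open ≤-Reasoning
  w : Vertex n → ℕ
  w z = b2n (R u z) + b2n ⌊ z ≟V v ⌋
  edge-weight : ∀ j → b2n (adj G a j) ≤ w (f j)
  edge-weight j with adj G a j in aj
  ... | false = z≤n
  ... | true  = ≤-trans (≤-reflexive (cong b2n (sym (f-pres a j aj)))) (addEdge-at-endpoint R u v u≢v (f j))

¬-implication : {x y : Bool} → ¬ (x ≡ true → y ≡ true) → x ≡ true × y ≡ false
¬-implication {true}  {false} _ = refl , refl
¬-implication {true}  {true}  h = contradiction (λ _ → refl) h
¬-implication {false}         h = contradiction (λ ()) h

unmapped-edge : ∀ {n} (G : SimpleGraph) (R : Vertex n → Vertex n → Bool) (f : Fin (k G) → Vertex n) →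
  ¬ (∀ a b → adj G a b ≡ true → R (f a) (f b) ≡ true) →
  Σ (Fin (k G)) λ a → Σ (Fin (k G)) λ b → adj G a b ≡ true × R (f a) (f b) ≡ false
unmapped-edge G R f not-copy = a , b , ¬-implication ¬ab-ok
  where
  edge? : ∀ a b → Dec (adj G a b ≡ true → R (f a) (f b) ≡ true)
  edge? a b = (adj G a b BoolP.≟ true) →-dec (R (f a) (f b) BoolP.≟ true)
  bad-vertex : Σ (Fin (k G)) λ a → ¬ (∀ b → adj G a b ≡ true → R (f a) (f b) ≡ true)
  bad-vertex = FinP.¬∀⟶∃¬ _ _ (λ a → FinP.all? (edge? a)) not-copy
  a : Fin (k G)
  a = proj₁ bad-vertex
  bad-neighbour : Σ (Fin (k G)) λ b → ¬ (adj G a b ≡ true → R (f a) (f b) ≡ true)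
  bad-neighbour = FinP.¬∀⟶∃¬ _ _ (edge? a) (proj₂ bad-vertex)
  b : Fin (k G)
  b = proj₁ bad-neighbour
  ¬ab-ok : ¬ (adj G a b ≡ true → R (f a) (f b) ≡ true)
  ¬ab-ok = proj₂ bad-neighbour

new-pair : ∀ r a b c d → r ≡ false → r ∨ (a ∧ b) ∨ (c ∧ d) ≡ true → (a ≡ true × b ≡ true) ⊎ (c ≡ true × d ≡ true)
new-pair false true  true  c    d    _ _ = inj₁ (refl , refl)
new-pair false true  false true true _ _ = inj₂ (refl , refl)
new-pair false false b     true true _ _ = inj₂ (refl , refl)

uses-new-edge : ∀ {n} (G : SimpleGraph) (R : Vertex n → Vertex n → Bool) (u v : Vertex n)
  (f : Fin (k G) → Vertex n) → IsCopy G (addEdge R u v) f → ¬ IsCopy G R f →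
  Σ (Fin (k G)) λ a → Σ (Fin (k G)) λ b → adj G a b ≡ true × f a ≡ u × f b ≡ v
uses-new-edge G R u v f (f-inj , f-pres) not-copy
  with unmapped-edge G R f (λ pres → not-copy (f-inj , pres))
... | a , b , ab , ab∉R with new-pair _ _ _ _ _ ab∉R (f-pres a b ab)
... | inj₁ (fa≡u , fb≡v) = a , b , ab , isYes-sound (f a ≟V u) fa≡u , isYes-sound (f b ≟V v) fb≡v
... | inj₂ (fa≡v , fb≡u) =
  b , a , trans (Defs.sym G b a) ab , isYes-sound (f b ≟V u) fb≡u , isYes-sound (f a ≟V v) fa≡v

∸1-≤ : ∀ {δ Z} → δ ≤ Z + 1 → δ ∸ 1 ≤ Z
∸1-≤ {δ} {Z} h = ≤-trans (∸-monoˡ-≤ 1 h) (≤-reflexive (m+n∸n≡m Z 1))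

max-split : ∀ {δ p q X Y} → δ ≤ p ⊔ q → p ≤ X + 1 → q ≤ Y + 1 → δ ∸ 1 ≤ X ⊎ δ ∸ 1 ≤ Y
max-split {δ} {p} {q} δ≤p⊔q p≤X+1 q≤Y+1 with ≤-total p q
... | inj₁ p≤q = inj₂ (∸1-≤ (≤-trans (subst (δ ≤_) (m≤n⇒m⊔n≡n p≤q) δ≤p⊔q) q≤Y+1))
... | inj₂ q≤p = inj₁ (∸1-≤ (≤-trans (subst (δ ≤_) (m≥n⇒m⊔n≡m q≤p) δ≤p⊔q) p≤X+1))

HighCover : ∀ {n} → ℕ → SubQ n → Set
HighCover d H = ∀ u v → QAdj u v → E H u v ≡ false → d ≤ degree (E H) u ⊎ d ≤ degree (E H) v

saturated-high-cover : ∀ {n} (G : SimpleGraph) (δ : ℕ) (H : SubQ n) →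
  IsEmin G δ → Saturated G H → HighCover (δ ∸ 1) H
saturated-high-cover G δ H (_ , emin≤) (no-copy , saturated) u v uv∈Q uv∉H
  with saturated u v uv∈Q uv∉H
... | f , copy@(f-inj , f-pres) with uses-new-edge G (E H) u v f copy (λ c → no-copy (f , c))
... | a , b , ab , fa≡u , fb≡v =
  max-split (emin≤ a b ab)
    (endpoint-degree G (E H) u v u≢v f copy a fa≡u)
    (endpoint-degree G (E H) v u (λ e → u≢v (sym e)) f copy-vu b fb≡v)
  where
  u≢v : ¬ u ≡ v
  u≢v = adjacent⇒≢ uv∈Q
  copy-vu : IsCopy G (addEdge (E H) v u) f
  copy-vu = f-inj , λ i j ij → trans (sym (addEdge-comm (E H) u v (f i) (f j))) (f-pres i j ij)

-- (2) Double counting vertex–direction pairs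

module DoubleCount {n : ℕ} (d : ℕ) (H : SubQ n) (cover : HighCover d H) where

  V : List (Vertex n)
  V = allVertices n

  F : List (Fin n)
  F = allFin n

  high : Vertex n → ℕ
  high x = b2n (d ≤ᵇ degree (E H) x)

  h : ℕ
  h = ∑ V high

  high-weight : ∀ x → d * high x ≤ degree (E H) x
  high-weight x with d ≤ᵇ degree (E H) x in d≤deg
  ... | true  = ≤-trans (≤-reflexive (*-identityʳ d)) (≤ᵇ⇒≤ d _ (subst T (sym d≤deg) tt))
  ... | false = ≤-trans (≤-reflexive (*-zeroʳ d)) z≤n

  few-high : d * h ≤ degreeSum H
  few-high = ≤-trans (≤-reflexive (sym (∑-*ˡ V d high))) (∑-mono V high-weight)

  high-is-one : ∀ x → d ≤ degree (E H) x → high x ≡ 1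
  high-is-one x d≤deg with d ≤ᵇ degree (E H) x | ≤⇒≤ᵇ d≤deg
  ... | true | _ = refl

  pair-covered : ∀ u i → 1 ≤ b2n (E H u (flipAt i u)) + (high u + high (flipAt i u))
  pair-covered u i with E H u (flipAt i u) in uv∈H
  ... | true  = s≤s z≤n
  ... | false with cover u (flipAt i u) (flipAt-adjacent i u) uv∈H
  ...   | inj₁ u-high rewrite high-is-one u u-high = s≤s z≤n
  ...   | inj₂ v-high rewrite high-is-one (flipAt i u) v-high = m≤n+m 1 (high u)

  high-neighbours : Vertex n → ℕ
  high-neighbours u = ∑ F (λ i → high (flipAt i u))

  vertex-count : ∀ u → n ≤ degree (E H) u + (n * high u + high-neighbours u)
  vertex-count u = begin
    n                                      ≡⟨ sym (trans (∑-const F 1) (trans (*-identityˡ _) (length-tabulate _))) ⟩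
    ∑ F (λ _ → 1)                          ≤⟨ ∑-mono F (pair-covered u) ⟩
    ∑ F (λ i → b2n (E H u (flipAt i u)) + (high u + high (flipAt i u)))
      ≡⟨ ∑-+ F _ _ ⟩
    ∑ F (λ i → b2n (E H u (flipAt i u))) + ∑ F (λ i → high u + high (flipAt i u))
      ≡⟨ cong (∑ F (λ i → b2n (E H u (flipAt i u))) +_) (trans (∑-+ F _ _) (cong (_+ high-neighbours u) high-u-times-n)) ⟩
    ∑ F (λ i → b2n (E H u (flipAt i u))) + (n * high u + high-neighbours u)
      ≤⟨ +-monoˡ-≤ _ (∑-injective-≤ (λ i → flipAt i u) (flipAt-injective-dir u) (λ z → b2n (E H u z))
                          F (UniqueP.allFin⁺ n) V (λ {i} _ → ∈-allVertices (flipAt i u))) ⟩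
    degree (E H) u + (n * high u + high-neighbours u) ∎
    where
    open ≤-Reasoning
    high-u-times-n : ∑ F (λ _ → high u) ≡ n * high u
    high-u-times-n = trans (∑-const F (high u)) (trans (cong (high u *_) (length-tabulate _)) (*-comm (high u) n))

  -- each vertex is the i-neighbour of exactly one vertex
  neighbours-count : ∑ V high-neighbours ≤ n * h
  neighbours-count = begin
    ∑ V high-neighbours                         ≡⟨ ∑-swap V F (λ u i → high (flipAt i u)) ⟩
    ∑ F (λ i → ∑ V (λ u → high (flipAt i u)))  ≤⟨ ∑-mono F (λ i → ∑-injective-≤ (flipAt i) (flipAt-injective i) high
                                                     V (allVertices-unique n) V (λ {x} _ → ∈-allVertices (flipAt i x))) ⟩
    ∑ F (λ _ → h)                               ≡⟨ trans (∑-const F h) (trans (cong (h *_) (length-tabulate _)) (*-comm h n)) ⟩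
    n * h                                       ∎
    where open ≤-Reasoning

  pairs-count : n * 2 ^ n ≤ degreeSum H + (n * h + n * h)
  pairs-count = begin
    n * 2 ^ n                           ≡⟨ sym (trans (∑-const V n) (cong (n *_) (length-allVertices n))) ⟩
    ∑ V (λ _ → n)                       ≤⟨ ∑-mono V vertex-count ⟩
    ∑ V (λ u → degree (E H) u + (n * high u + high-neighbours u))
      ≡⟨ trans (∑-+ V _ _) (cong (degreeSum H +_) (trans (∑-+ V _ _) (cong (_+ ∑ V high-neighbours) (∑-*ˡ V n high)))) ⟩
    degreeSum H + (n * h + ∑ V high-neighbours)
      ≤⟨ +-monoʳ-≤ (degreeSum H) (+-monoʳ-≤ (n * h) neighbours-count) ⟩
    degreeSum H + (n * h + n * h)       ∎
    where open ≤-Reasoning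

  bound : d * (n * 2 ^ n) ≤ (d + 2 * n) * degreeSum H
  bound = begin
    d * (n * 2 ^ n)                         ≤⟨ *-monoʳ-≤ d pairs-count ⟩
    d * (D + (n * h + n * h))               ≡⟨ spread d D n h ⟩
    d * D + (n * (d * h) + n * (d * h))     ≤⟨ +-monoʳ-≤ (d * D) (+-mono-≤ (*-monoʳ-≤ n few-high) (*-monoʳ-≤ n few-high)) ⟩
    d * D + (n * D + n * D)                 ≡⟨ collect d D n ⟩
    (d + 2 * n) * D                         ∎
    where
    open ≤-Reasoning
    D : ℕ
    D = degreeSum H
    spread : ∀ d D n h → d * (D + (n * h + n * h)) ≡ d * D + (n * (d * h) + n * (d * h))
    spread = solve-∀
    collect : ∀ d D n → d * D + (n * D + n * D) ≡ (d + 2 * n) * D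
    collect = solve-∀

-- (3) Arithmetic

-- With K = d + 2n: from d·n·P ≤ K·D and D ≤ 2q + 1, once n is large
-- (n ≥ 1, d²M ≤ n, 2Md + 4M ≤ P) we get d·P·M ≤ 4qM + P.  Multiplying
-- through by K, the main terms match and the lower-order terms
-- d²PM + 2MK are absorbed by K·P.
large-n-bound : ∀ d M n P D q → 1 ≤ n → d * d * M ≤ n → 2 * M * d + 4 * M ≤ P →
  d * (n * P) ≤ (d + 2 * n) * D → D ≤ 2 * q + 1 → d * P * M ≤ 4 * q * M + P
large-n-bound d M n P D q 1≤n d²M≤n P-large counted D≤2q+1 =
  *-cancelˡ-≤ K {{>-nonZero (≤-trans 1≤n (≤-trans (m≤m+n n (n + 0)) (m≤n+m (2 * n) d)))}} scaled
  where
  open ≤-Reasoning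
  K : ℕ
  K = d + 2 * n

  linear-in-n : 2 * M * d + 4 * M * n ≤ n * P
  linear-in-n = begin
    2 * M * d + 4 * M * n       ≤⟨ +-monoˡ-≤ (4 * M * n) (m≤n*m (2 * M * d) n {{>-nonZero 1≤n}}) ⟩
    n * (2 * M * d) + 4 * M * n ≡⟨ factor-n n M d ⟩
    n * (2 * M * d + 4 * M)     ≤⟨ *-monoʳ-≤ n P-large ⟩
    n * P                       ∎
    where
    factor-n : ∀ n M d → n * (2 * M * d) + 4 * M * n ≡ n * (2 * M * d + 4 * M)
    factor-n = solve-∀

  lower-order : d * d * P * M + 2 * M * K ≤ K * P
  lower-order = begin
    d * d * P * M + 2 * M * K           ≡⟨ regroup d M n P ⟩
    d * d * M * P + (2 * M * d + 4 * M * n) ≤⟨ +-mono-≤ (*-monoˡ-≤ P d²M≤n) linear-in-n ⟩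
    n * P + n * P                       ≤⟨ m≤n+m (n * P + n * P) (d * P) ⟩
    d * P + (n * P + n * P)             ≡⟨ collect d n P ⟩
    K * P                               ∎
    where
    regroup : ∀ d M n P → d * d * P * M + 2 * M * (d + 2 * n) ≡ d * d * M * P + (2 * M * d + 4 * M * n)
    regroup = solve-∀
    collect : ∀ d n P → d * P + (n * P + n * P) ≡ (d + 2 * n) * P
    collect = solve-∀

  scaled : K * (d * P * M) ≤ K * (4 * q * M + P)
  scaled = begin
    K * (d * P * M)                         ≡⟨ split d n P M ⟩
    d * d * P * M + 2 * M * (d * (n * P))   ≤⟨ +-monoʳ-≤ (d * d * P * M) (*-monoʳ-≤ (2 * M) (≤-trans counted (*-monoʳ-≤ K D≤2q+1))) ⟩
    d * d * P * M + 2 * M * (K * (2 * q + 1)) ≡⟨ expand d n P M q ⟩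
    K * (4 * q * M) + (d * d * P * M + 2 * M * K) ≤⟨ +-monoʳ-≤ (K * (4 * q * M)) lower-order ⟩
    K * (4 * q * M) + K * P                 ≡⟨ sym (*-distribˡ-+ K (4 * q * M) P) ⟩
    K * (4 * q * M + P)                     ∎
    where
    split : ∀ d n P M → (d + 2 * n) * (d * P * M) ≡ d * d * P * M + 2 * M * (d * (n * P))
    split = solve-∀
    expand : ∀ d n P M q → d * d * P * M + 2 * M * ((d + 2 * n) * (2 * q + 1))
                          ≡ (d + 2 * n) * (4 * q * M) + (d * d * P * M + 2 * M * (d + 2 * n))
    expand = solve-∀

theorem2 : (G : SimpleGraph) → HasEdge G → (δ : ℕ) → IsEmin G δ →
    (m : ℕ) → Σ ℕ λ N → (n : ℕ) → N ≤ n → (H : SubQ n) → Saturated G H →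
      (δ ∸ 1) * 2 ^ n * suc m ≤ 4 * edgeCount H * suc m + 2 ^ n
theorem2 G _ δ emin m = suc threshold , λ n N≤n H saturated →
  let threshold≤n : threshold ≤ n
      threshold≤n = ≤-trans (n≤1+n threshold) N≤n
  in large-n-bound d M n (2 ^ n) (degreeSum H) (edgeCount H)
       (≤-trans (s≤s z≤n) N≤n)
       (≤-trans (m≤m+n (d * d * M) _) threshold≤n)
       (≤-trans (m≤n+m _ (d * d * M)) (≤-trans threshold≤n (<⇒≤ (n<2^n n))))
       (DoubleCount.bound d H (saturated-high-cover G δ H emin saturated))
       (degreeSum≤2edgeCount+1 H)
  where
  d M threshold : ℕ
  d = δ ∸ 1
  M = suc m
  threshold = d * d * M + (2 * M * d + 4 * M)
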